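{- Let $\phi$ be a predicate, $\sigma$ a valuation, $\Delta$ a database instance, and let $c$ be a tuple of a relation $R$ of the schema. Then $\varsigma(\Delta)\uplus\sigma\uplus[x\mapsto \varsigma(c)]\models \varsigma(\phi)(x)$ if and only if $[\![\phi]\!]_{\sigma,\Delta,c}$ is true.
   Context: Predicates $\phi$ over a schema (relation names mapped to attribute lists $a_1,\dots,a_n$) are boolean combinations ($\wedge,\vee,\neg$) of atoms $a\odot a'$, $a\odot v$, $a\in Q$ with $\odot\in\{\le,<,=,\ne,>,\ge\}$, $v$ a variable or constant, and $Q$ a query $Q ::= R\mid \Pi_\psi(Q)\mid \sigma_\phi(Q)\mid Q\bowtie_\phi Q\mid Q\cup Q\mid Q-Q$. A database instance $\Delta$ maps relation names to finite lists of tuples (maps from attributes to values); a valuation $\sigma$ maps variables to values. Query semantics $[\![Q]\!]_{\sigma,\Delta}$: $R$ gives $\Delta(R)$; $\Pi_\psi$ restricts tuples to attributes in $\psi$; $\sigma_\phi$ keeps tuples $x$ with $[\![\phi]\!]_{\sigma,\Delta,x}$ true; $\times$ lists merged pairs $y\cup z$ for $y$ in the first and $z$ in the second (nested, in order); $\bowtie_\phi=\sigma_\phi\circ\times$; $\cup$ concatenates; $Q_1-Q_2$ deletes from $[\![Q_1]\!]$ the first occurrence of each element of $[\![Q_2]\!]$ in turn. Predicate semantics $[\![\phi]\!]_{\sigma,\Delta,x}$ on a tuple $x$: $a\odot a'$ is $x(a)\odot x(a')$; $a\odot v$ is $x(a)\odot v[\sigma]$; $a\in Q$ holds iff $x(a)$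 occurs among the first values of the tuples of $[\![Q]\!]_{\sigma,\Delta}$; connectives standard. In the theory $\mathcal{T}_{RA}$, relation terms denote finite lists of rows (finite lists of values); predicates on a row $x$ are built from $a_i\odot a_j$, $a_i\odot v$, $a_i\in t$ (the $i$-th component of $x$ occurs among the first components of the rows denoted by $t$) and boolean connectives, $a_i$ denoting the $i$-th component. Term operators: $\Pi$ keeps the listed components of each row; $\sigma_\phi$ filters rows; $t_1\times t_2$ lists concatenations $y{+}{+}z$ for rows $y$ of $t_1$ and then $z$ of $t_2$; $\cup$ concatenates; $t_1-t_2$ deletes the first occurrence of each row of $t_2$ in turn. $\varsigma$ translates program syntax into $\mathcal{T}_{RA}$ by replacing each attribute name by $a_i$ where $i$ is its position; $\varsigma(c)$ is the row $[v_1,\dots,v_n]$ of the tuple $c=\{a_1:v_1,\dots,a_n:v_n\}$ (attributes in schema order); $\varsigma(\Delta)$ interprets each relation symbol $R$ as the list of rows $\varsigma(c)$ for $c$ in $\Delta(R)$; $\varsigma(\phi)(x)$ is the translated predicate evaluated on row $x$. -}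

module Defs where

open import Data.Nat using (ℕ; zero; suc; _≡ᵇ_; _<ᵇ_; _≤ᵇ_)
open import Data.Bool using (Bool; true; false; not; _∧_; _∨_; T)
open import Data.List using (List; []; _∷_; _++_; map; concatMap; filterᵇ; length)
open import Data.Bool.ListAction using (any; all)
open import Data.Product using (_×_; _,_; proj₁; proj₂)
open import Data.List.Membership.Propositional using (_∈_)
open import Data.List.Relation.Unary.All using (All)
open import Relation.Binary.PropositionalEquality using (_≡_)
open import Relation.Nullary using (¬_)

Attr : Set
Attr = ℕ

Val : Set
Val = ℕ

Var : Set
Var = ℕ

RelName : Set
RelName = ℕ

data Cmp : Set where
  le lt eq ne gt ge : Cmp

cmp : Cmp → Val → Val → Bool
cmp le x y = x ≤ᵇ y
cmp lt x y = x <ᵇ y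
cmp eq x y = x ≡ᵇ y
cmp ne x y = not (x ≡ᵇ y)
cmp gt x y = y <ᵇ x
cmp ge x y = y ≤ᵇ x

data Operand : Set where
  var   : Var → Operand
  const : Val → Operand

Valuation : Set
Valuation = Var → Val

_[_] : Operand → Valuation → Val
var x   [ σ ] = σ x
const k [ σ ] = k

member : ℕ → List ℕ → Bool
member a = any (λ b → a ≡ᵇ b)

data Query : Set
data Pred : Set

data Query where
  rel   : RelName → Query
  proj  : List Attr → Query → Query
  sel   : Pred → Query → Query
  join  : Pred → Query → Query → Query
  union : Query → Query → Query
  diff  : Query → Query → Query

data Pred where
  attAtt : Attr → Cmp → Attr → Pred
  attVal : Attr → Cmp → Operand → Pred
  attIn  : Attr → Query → Pred
  and    : Pred → Pred → Pred
  or     : Pred → Pred → Pred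
  neg    : Pred → Pred

Schema : Set
Schema = RelName → List Attr

-- a tuple is a finite map from attributes to values (association list)
Tuple : Set
Tuple = List (Attr × Val)

dom : Tuple → List Attr
dom = map proj₁

-- x(a) (first binding; 0 if unbound -- never happens for well-formed data)
get : Tuple → Attr → Val
get [] a = 0
get ((b , v) ∷ x) a with a ≡ᵇ b
... | true  = v
... | false = get x a

tupleEq : Tuple → Tuple → Bool
tupleEq y z =
  all (λ a → member a (dom z)) (dom y) ∧
  all (λ a → member a (dom y)) (dom z) ∧
  all (λ a → get y a ≡ᵇ get z a) (dom y)

DB : Set
DB = RelName → List Tuple

sch : Schema → Query → List Attr
sch s (rel R)       = s R
sch s (proj ψ Q)    = ψ
sch s (sel φ Q)     = sch s Q
sch s (join φ Q Q') = sch s Q ++ sch s Q'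
sch s (union Q Q')  = sch s Q
sch s (diff Q Q')   = sch s Q

head0 : List ℕ → ℕ
head0 []      = 0
head0 (a ∷ _) = a

restrict : List Attr → Tuple → Tuple
restrict ψ = filterᵇ (λ p → member (proj₁ p) ψ)

cross : {A : Set} → (A → A → A) → List A → List A → List A
cross f ys zs = concatMap (λ y → map (λ z → f y z) zs) ys

deleteFirst : {A : Set} → (A → A → Bool) → A → List A → List A
deleteFirst eqb a []      = []
deleteFirst eqb a (b ∷ l) with eqb a b
... | true  = l
... | false = b ∷ deleteFirst eqb a l

minus : {A : Set} → (A → A → Bool) → List A → List A → List A
minus eqb l1 []       = l1
minus eqb l1 (z ∷ l2) = minus eqb (deleteFirst eqb z l1) l2

evalQ : Schema → Valuation → DB → Query → List Tuple
evalP : Schema → Valuation → DB → Tuple → Pred → Bool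

evalQ s σ Δ (rel R)       = Δ R
evalQ s σ Δ (proj ψ Q)    = map (restrict ψ) (evalQ s σ Δ Q)
evalQ s σ Δ (sel φ Q)     = filterᵇ (λ x → evalP s σ Δ x φ) (evalQ s σ Δ Q)
evalQ s σ Δ (join φ Q Q') =
  filterᵇ (λ x → evalP s σ Δ x φ) (cross _++_ (evalQ s σ Δ Q) (evalQ s σ Δ Q'))
evalQ s σ Δ (union Q Q')  = evalQ s σ Δ Q ++ evalQ s σ Δ Q'
evalQ s σ Δ (diff Q Q')   = minus tupleEq (evalQ s σ Δ Q) (evalQ s σ Δ Q')

evalP s σ Δ x (attAtt a o a') = cmp o (get x a) (get x a')
evalP s σ Δ x (attVal a o v)  = cmp o (get x a) (v [ σ ])
evalP s σ Δ x (attIn a Q)     =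
  any (λ y → get x a ≡ᵇ get y (head0 (sch s Q))) (evalQ s σ Δ Q)
evalP s σ Δ x (and φ ψ) = evalP s σ Δ x φ ∧ evalP s σ Δ x ψ
evalP s σ Δ x (or φ ψ)  = evalP s σ Δ x φ ∨ evalP s σ Δ x ψ
evalP s σ Δ x (neg φ)   = not (evalP s σ Δ x φ)

Row : Set
Row = List Val

data Term : Set
data TPred : Set

data Term where
  trel   : RelName → Term
  tproj  : List ℕ → Term → Term
  tsel   : TPred → Term → Term
  tcross : Term → Term → Term
  tunion : Term → Term → Term
  tdiff  : Term → Term → Term

data TPred where
  tatt : ℕ → Cmp → ℕ → TPred
  tval : ℕ → Cmp → Operand → TPred
  tin  : ℕ → Term → TPred
  tand : TPred → TPred → TPred
  tor  : TPred → TPred → TPred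
  tneg : TPred → TPred

-- i-th component of a row (0 if out of range)
comp : Row → ℕ → Val
comp []      i       = 0
comp (v ∷ r) zero    = v
comp (v ∷ r) (suc i) = comp r i

rowEq : Row → Row → Bool
rowEq []      []      = true
rowEq (u ∷ r) (v ∷ q) = (u ≡ᵇ v) ∧ rowEq r q
rowEq _       _       = false

-- a structure for T_RA: interpretation of relation symbols, variables,
-- and of the distinguished row variable x
record Interp : Set where
  constructor interp
  field
    rels : RelName → List Row
    vals : Valuation
    xrow : Row

evalT : (RelName → List Row) → Valuation → Term → List Row
holdsT : (RelName → List Row) → Valuation → Row → TPred → Bool

evalT ρ σ (trel R)      = ρ R
evalT ρ σ (tproj is t)  = map (λ r → map (comp r) is) (evalT ρ σ t)
evalT ρ σ (tsel φ t)    = filterᵇ (λ r → holdsT ρ σ r φ) (evalT ρ σ t)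
evalT ρ σ (tcross t u)  = cross _++_ (evalT ρ σ t) (evalT ρ σ u)
evalT ρ σ (tunion t u)  = evalT ρ σ t ++ evalT ρ σ u
evalT ρ σ (tdiff t u)   = minus rowEq (evalT ρ σ t) (evalT ρ σ u)

holdsT ρ σ x (tatt i o j) = cmp o (comp x i) (comp x j)
holdsT ρ σ x (tval i o v) = cmp o (comp x i) (v [ σ ])
holdsT ρ σ x (tin i t)    = any (λ r → comp x i ≡ᵇ comp r 0) (evalT ρ σ t)
holdsT ρ σ x (tand φ ψ)   = holdsT ρ σ x φ ∧ holdsT ρ σ x ψ
holdsT ρ σ x (tor φ ψ)    = holdsT ρ σ x φ ∨ holdsT ρ σ x ψ
holdsT ρ σ x (tneg φ)     = not (holdsT ρ σ x φ)

_⊨_ : Interp → TPred → Set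
M ⊨ φ = T (holdsT (Interp.rels M) (Interp.vals M) (Interp.xrow M) φ)

pos : List Attr → Attr → ℕ
pos []      a = 0
pos (b ∷ S) a with a ≡ᵇ b
... | true  = 0
... | false = suc (pos S a)

ςQ : Schema → Query → Term
ςP : Schema → List Attr → Pred → TPred

ςQ s (rel R)       = trel R
ςQ s (proj ψ Q)    = tproj (map (pos (sch s Q)) ψ) (ςQ s Q)
ςQ s (sel φ Q)     = tsel (ςP s (sch s Q) φ) (ςQ s Q)
ςQ s (join φ Q Q') = tsel (ςP s (sch s Q ++ sch s Q') φ) (tcross (ςQ s Q) (ςQ s Q'))
ςQ s (union Q Q')  = tunion (ςQ s Q) (ςQ s Q')
ςQ s (diff Q Q')   = tdiff (ςQ s Q) (ςQ s Q')

ςP s S (attAtt a o a') = tatt (pos S a) o (pos S a')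
ςP s S (attVal a o v)  = tval (pos S a) o v
ςP s S (attIn a Q)     = tin (pos S a) (ςQ s Q)
ςP s S (and φ ψ)       = tand (ςP s S φ) (ςP s S ψ)
ςP s S (or φ ψ)        = tor (ςP s S φ) (ςP s S ψ)
ςP s S (neg φ)         = tneg (ςP s S φ)

ςTuple : List Attr → Tuple → Row
ςTuple S c = map (get c) S

ςDB : Schema → DB → RelName → List Row
ςDB s Δ R = map (ςTuple (s R)) (Δ R)

Disjoint : List Attr → List Attr → Set
Disjoint S S' = ∀ {a} → a ∈ S → ¬ (a ∈ S')

WFTuple : List Attr → Tuple → Set
WFTuple S c = All (_∈ S) (dom c) × All (_∈ dom c) S

WFDB : Schema → DB → Set
WFDB s Δ = ∀ R → All (WFTuple (s R)) (Δ R)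

data WFQ (s : Schema) : Query → Set
data WFP (s : Schema) (S : List Attr) : Pred → Set

data WFQ s where
  wrel   : ∀ {R} → WFQ s (rel R)
  wproj  : ∀ {ψ Q} → WFQ s Q → All (_∈ sch s Q) ψ → WFQ s (proj ψ Q)
  wsel   : ∀ {φ Q} → WFQ s Q → WFP s (sch s Q) φ → WFQ s (sel φ Q)
  wjoin  : ∀ {φ Q Q'} → WFQ s Q → WFQ s Q' → Disjoint (sch s Q) (sch s Q') →
           WFP s (sch s Q ++ sch s Q') φ → WFQ s (join φ Q Q')
  wunion : ∀ {Q Q'} → WFQ s Q → WFQ s Q' → sch s Q ≡ sch s Q' → WFQ s (union Q Q')
  wdiff  : ∀ {Q Q'} → WFQ s Q → WFQ s Q' → sch s Q ≡ sch s Q' → WFQ s (diff Q Q')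

data WFP s S where
  wattAtt : ∀ {a o a'} → a ∈ S → a' ∈ S → WFP s S (attAtt a o a')
  wattVal : ∀ {a o v} → a ∈ S → WFP s S (attVal a o v)
  wattIn  : ∀ {a Q} → a ∈ S → WFQ s Q → WFP s S (attIn a Q)
  wand    : ∀ {φ ψ} → WFP s S φ → WFP s S ψ → WFP s S (and φ ψ)
  wor     : ∀ {φ ψ} → WFP s S φ → WFP s S ψ → WFP s S (or φ ψ)
  wneg    : ∀ {φ} → WFP s S φ → WFP s S (neg φ)

-- ς commutes with evaluation, by simultaneous induction on well-formed queries
-- and predicates: the term ς(Q) denotes the rows ς(c) of the tuples c of ⟦Q⟧,
-- and ς(φ) holds of the row ς(x) exactly when ⟦φ⟧ holds of x.  An attribute a of
-- S is found by ς at position pos S a, and that component of ς(x) is x(a).  The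
-- standing well-formedness assumptions make the remaining operators commute with
-- ς: disjoint schemas turn merged tuples into concatenated rows (joins), rows of
-- tuples over the same schema are equal exactly when the tuples are equal as
-- finite maps (differences), and the first component of ς(y) is y at the first
-- attribute (membership atoms).
module Submission where

open import Defs
open import Data.Bool using (Bool; true; false; not; _∧_; _∨_; T)
open import Data.Bool.Properties using (T-≡; ⇔→≡; not-¬)
open import Data.Bool.ListAction as ListAction using (any; all)
open import Data.Nat using (_≡ᵇ_)
open import Data.Nat.Properties using (≡ᵇ⇒≡; ≡⇒≡ᵇ)
open import Data.List using (List; []; _∷_; _++_; map; filterᵇ)
open import Data.List.Properties using (map-++; map-∘; map-cong; map-cong-local)
open import Data.List.Membership.Propositional using (_∈_; _∉_)
open import Data.List.Membership.Propositional.Properties using (∈-++⁺ˡ; ∈-++⁺ʳ)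
open import Data.List.Relation.Binary.Subset.Propositional using (_⊆_)
open import Data.List.Relation.Unary.All as All using (All; []; _∷_)
open import Data.List.Relation.Unary.All.Properties using (++⁺; map⁺; concat⁺; filter⁺; all⁻; all-anti-mono)
open import Data.List.Relation.Unary.Any as Any using (here; there)
open import Data.List.Relation.Unary.Any.Properties using (any⁺; any⁻)
open import Data.Product using (_,_; proj₁)
open import Relation.Nullary using (contradiction)
open import Relation.Binary.PropositionalEquality
  using (_≡_; refl; sym; trans; cong; cong₂; subst; module ≡-Reasoning)
open import Function.Bundles using (_⇔_; mk⇔; module Equivalence)

open Equivalence using (to; from)

≡ᵇ-refl : ∀ n → (n ≡ᵇ n) ≡ true
≡ᵇ-refl n = to T-≡ (≡⇒≡ᵇ n n refl)

≡ᵇ-sound : ∀ {m n} → (m ≡ᵇ n) ≡ true → m ≡ n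
≡ᵇ-sound {m} {n} e = ≡ᵇ⇒≡ m n (from T-≡ e)

∈⇒member : ∀ {a L} → a ∈ L → member a L ≡ true
∈⇒member {a} a∈L = to T-≡ (any⁺ (a ≡ᵇ_) (Any.map (λ {b} → ≡⇒≡ᵇ a b) a∈L))

member⇒∈ : ∀ a L → member a L ≡ true → a ∈ L
member⇒∈ a L e = Any.map (λ {b} → ≡ᵇ⇒≡ a b) (any⁻ (a ≡ᵇ_) L (from T-≡ e))

⊆∧⊇⇒all≡ : ∀ {A : Set} (p : A → Bool) {xs ys : List A} →
           xs ⊆ ys → ys ⊆ xs → all p xs ≡ all p ys
⊆∧⊇⇒all≡ p xs⊆ys ys⊆xs = ⇔→≡ (mk⇔ (restrictTo ys⊆xs) (restrictTo xs⊆ys))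
  where
  restrictTo : ∀ {us vs} → us ⊆ vs → all p vs ≡ true → all p us ≡ true
  restrictTo us⊆vs e = to T-≡ (all-anti-mono p us⊆vs (from T-≡ e))

module _ {A B : Set} where

  filterᵇ-map : ∀ (p : B → Bool) (q : A → Bool) (f : A → B) →
                (∀ x → p (f x) ≡ q x) → ∀ xs → filterᵇ p (map f xs) ≡ map f (filterᵇ q xs)
  filterᵇ-map p q f p∘f≗q []       = refl
  filterᵇ-map p q f p∘f≗q (x ∷ xs) with p (f x) | q x | p∘f≗q x
  ... | true  | .true  | refl = cong (f x ∷_) (filterᵇ-map p q f p∘f≗q xs)
  ... | false | .false | refl = filterᵇ-map p q f p∘f≗q xs

  any-map-local : ∀ (p : B → Bool) (q : A → Bool) (f : A → B) {xs} →
                  All (λ x → p (f x) ≡ q x) xs → any p (map f xs) ≡ any q xs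
  any-map-local p q f {xs} p∘f≗q = cong ListAction.or (trans (sym (map-∘ xs)) (map-cong-local p∘f≗q))

  cross-map : ∀ {P Q : A → Set} (_⊗_ : A → A → A) (_⊕_ : B → B → B) (f g h : A → B) →
              (∀ {y z} → P y → Q z → f y ⊕ g z ≡ h (y ⊗ z)) →
              ∀ {ys zs} → All P ys → All Q zs →
              cross _⊕_ (map f ys) (map g zs) ≡ map h (cross _⊗_ ys zs)
  cross-map _⊗_ _⊕_ f g h hom []                 qs = refl
  cross-map _⊗_ _⊕_ f g h hom {y ∷ ys} {zs} (py ∷ ps) qs = begin
    map (f y ⊕_) (map g zs) ++ cross _⊕_ (map f ys) (map g zs)
      ≡⟨ cong₂ _++_ row (cross-map _⊗_ _⊕_ f g h hom ps qs) ⟩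
    map h (map (y ⊗_) zs) ++ map h (cross _⊗_ ys zs)
      ≡⟨ map-++ h (map (y ⊗_) zs) (cross _⊗_ ys zs) ⟨
    map h (cross _⊗_ (y ∷ ys) zs) ∎
    where
    open ≡-Reasoning
    row : map (f y ⊕_) (map g zs) ≡ map h (map (y ⊗_) zs)
    row = trans (sym (map-∘ zs)) (trans (map-cong-local (All.map (hom py) qs)) (map-∘ zs))

  deleteFirst-map : ∀ (eqB : B → B → Bool) (eqA : A → A → Bool) (f : A → B) x {xs} →
                    All (λ y → eqB (f x) (f y) ≡ eqA x y) xs →
                    deleteFirst eqB (f x) (map f xs) ≡ map f (deleteFirst eqA x xs)
  deleteFirst-map eqB eqA f x []                   = refl
  deleteFirst-map eqB eqA f x {y ∷ xs} (e ∷ es) with eqB (f x) (f y) | eqA x y | e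
  ... | true  | .true  | refl = refl
  ... | false | .false | refl = cong (f y ∷_) (deleteFirst-map eqB eqA f x es)

All-cross : ∀ {A : Set} {P Q R : A → Set} (_⊗_ : A → A → A) → (∀ {y z} → P y → Q z → R (y ⊗ z)) →
            ∀ {ys zs} → All P ys → All Q zs → All R (cross _⊗_ ys zs)
All-cross _⊗_ combine ps qs = concat⁺ (map⁺ (All.map (λ py → map⁺ (All.map (combine py) qs)) ps))

module _ {A : Set} {P : A → Set} where

  All-deleteFirst : ∀ (eqb : A → A → Bool) x {xs} → All P xs → All P (deleteFirst eqb x xs)
  All-deleteFirst eqb x []                = []
  All-deleteFirst eqb x {y ∷ xs} (py ∷ ps) with eqb x y
  ... | true  = ps
  ... | false = py ∷ All-deleteFirst eqb x ps

  All-minus : ∀ (eqb : A → A → Bool) {xs} ys → All P xs → All P (minus eqb xs ys)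
  All-minus eqb []       ps = ps
  All-minus eqb (y ∷ ys) ps = All-minus eqb ys (All-deleteFirst eqb y ps)

  minus-map : ∀ {B : Set} (eqB : B → B → Bool) (eqA : A → A → Bool) (f : A → B) →
              (∀ {x y} → P x → P y → eqB (f x) (f y) ≡ eqA x y) →
              ∀ {xs} ys → All P xs → All P ys → minus eqB (map f xs) (map f ys) ≡ map f (minus eqA xs ys)
  minus-map eqB eqA f f-reflects []       ps qs        = refl
  minus-map eqB eqA f f-reflects {xs} (y ∷ ys) ps (py ∷ qs) =
    trans (cong (λ l → minus eqB l (map f ys))
                (deleteFirst-map eqB eqA f y (All.map (f-reflects py) ps)))
          (minus-map eqB eqA f f-reflects ys (All-deleteFirst eqA y ps) qs)

rowEq-map : ∀ {A : Set} (f g : A → Val) xs → rowEq (map f xs) (map g xs) ≡ all (λ x → f x ≡ᵇ g x) xs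
rowEq-map f g []       = refl
rowEq-map f g (x ∷ xs) = cong ((f x ≡ᵇ g x) ∧_) (rowEq-map f g xs)

comp-map-pos : ∀ (f : Attr → Val) S {a} → a ∈ S → comp (map f S) (pos S a) ≡ f a
comp-map-pos f (b ∷ S) {a} a∈S with a ≡ᵇ b in a≟b | a∈S
... | true  | _         = cong f (sym (≡ᵇ-sound a≟b))
... | false | here refl = contradiction a≟b (not-¬ (≡ᵇ-refl a))
... | false | there a∈S′ = comp-map-pos f S a∈S′

get-++ˡ : ∀ y z {a} → a ∈ dom y → get (y ++ z) a ≡ get y a
get-++ˡ ((b , v) ∷ y) z {a} a∈y with a ≡ᵇ b in a≟b | a∈y
... | true  | _         = refl
... | false | here refl = contradiction a≟b (not-¬ (≡ᵇ-refl a))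
... | false | there a∈y′ = get-++ˡ y z a∈y′

get-++ʳ : ∀ y z {a} → a ∉ dom y → get (y ++ z) a ≡ get z a
get-++ʳ []            z a∉y = refl
get-++ʳ ((b , v) ∷ y) z {a} a∉y with a ≡ᵇ b in a≟b
... | true  = contradiction (here (≡ᵇ-sound a≟b)) a∉y
... | false = get-++ʳ y z (λ a∈y → a∉y (there a∈y))

get-restrict : ∀ ψ y {a} → a ∈ ψ → get (restrict ψ y) a ≡ get y a
get-restrict ψ []            a∈ψ = refl
get-restrict ψ ((b , v) ∷ y) {a} a∈ψ with member b ψ in b∈?ψ
... | true  with a ≡ᵇ b
...   | true  = refl
...   | false = get-restrict ψ y a∈ψ
get-restrict ψ ((b , v) ∷ y) {a} a∈ψ | false with a ≡ᵇ b in a≟b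
...   | true  = contradiction b∈?ψ (not-¬ (∈⇒member (subst (_∈ ψ) (≡ᵇ-sound a≟b) a∈ψ)))
...   | false = get-restrict ψ y a∈ψ

dom-restrict : ∀ ψ y → All (_∈ ψ) (dom (restrict ψ y))
dom-restrict ψ []            = []
dom-restrict ψ ((b , v) ∷ y) with member b ψ in b∈?ψ
... | true  = member⇒∈ b ψ b∈?ψ ∷ dom-restrict ψ y
... | false = dom-restrict ψ y

∈-dom-restrict : ∀ ψ y {a} → a ∈ dom y → a ∈ ψ → a ∈ dom (restrict ψ y)
∈-dom-restrict ψ ((b , v) ∷ y) a∈y a∈ψ with member b ψ in b∈?ψ | a∈y
... | true  | here refl  = here refl
... | true  | there a∈y′ = there (∈-dom-restrict ψ y a∈y′ a∈ψ)
... | false | here refl  = contradiction b∈?ψ (not-¬ (∈⇒member a∈ψ))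
... | false | there a∈y′ = ∈-dom-restrict ψ y a∈y′ a∈ψ

WFTuple-restrict : ∀ {S} ψ y → All (_∈ S) ψ → WFTuple S y → WFTuple ψ (restrict ψ y)
WFTuple-restrict ψ y ψ⊆S (_ , S⊆y) =
  dom-restrict ψ y , All.tabulate (λ a∈ψ → ∈-dom-restrict ψ y (All.lookup S⊆y (All.lookup ψ⊆S a∈ψ)) a∈ψ)

WFTuple-++ : ∀ {S S′} y z → WFTuple S y → WFTuple S′ z → WFTuple (S ++ S′) (y ++ z)
WFTuple-++ {S} {S′} y z (y⊆S , S⊆y) (z⊆S′ , S′⊆z) rewrite map-++ proj₁ y z =
  ++⁺ (All.map ∈-++⁺ˡ y⊆S) (All.map (∈-++⁺ʳ S) z⊆S′) ,
  ++⁺ (All.map ∈-++⁺ˡ S⊆y) (All.map (∈-++⁺ʳ (dom y)) S′⊆z)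

ςTuple-++ : ∀ S S′ y z → WFTuple S y → Disjoint S S′ →
            ςTuple S y ++ ςTuple S′ z ≡ ςTuple (S ++ S′) (y ++ z)
ςTuple-++ S S′ y z (y⊆S , S⊆y) S#S′ = begin
  map (get y) S ++ map (get z) S′
    ≡⟨ cong₂ _++_ (map-cong-local (All.map (λ a∈y → sym (get-++ˡ y z a∈y)) S⊆y))
                  (map-cong-local (All.tabulate (λ a∈S′ → sym (get-++ʳ y z (S′∉y a∈S′))))) ⟩
  map (get (y ++ z)) S ++ map (get (y ++ z)) S′
    ≡⟨ map-++ (get (y ++ z)) S S′ ⟨
  map (get (y ++ z)) (S ++ S′) ∎
  where
  open ≡-Reasoning
  S′∉y : ∀ {a} → a ∈ S′ → a ∉ dom y
  S′∉y a∈S′ a∈y = S#S′ (All.lookup y⊆S a∈y) a∈S′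

-- On tuples over a common schema the two domain-inclusion conjuncts of tupleEq are true,
-- and its value comparison ranges over the same attributes as rowEq.
rowEq-ςTuple : ∀ {S y z} → WFTuple S y → WFTuple S z → rowEq (ςTuple S y) (ςTuple S z) ≡ tupleEq y z
rowEq-ςTuple {S} {y} {z} (y⊆S , S⊆y) (z⊆S , S⊆z) = begin
  rowEq (map (get y) S) (map (get z) S)                    ≡⟨ rowEq-map (get y) (get z) S ⟩
  all agree S                                              ≡⟨ ⊆∧⊇⇒all≡ agree (All.lookup S⊆y) (All.lookup y⊆S) ⟩
  all agree (dom y)                                        ≡⟨ cong₂ (λ u v → u ∧ v ∧ all agree (dom y)) y⊆z z⊆y ⟨
  tupleEq y z ∎
  where
  open ≡-Reasoning
  agree : Attr → Bool
  agree a = get y a ≡ᵇ get z a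
  y⊆z : all (λ a → member a (dom z)) (dom y) ≡ true
  y⊆z = to T-≡ (all⁻ _ (All.map (λ a∈S → from T-≡ (∈⇒member (All.lookup S⊆z a∈S))) y⊆S))
  z⊆y : all (λ a → member a (dom y)) (dom z) ≡ true
  z⊆y = to T-≡ (all⁻ _ (All.map (λ a∈S → from T-≡ (∈⇒member (All.lookup S⊆y a∈S))) z⊆S))

comp-ςTuple-head : ∀ S y → WFTuple S y → comp (ςTuple S y) 0 ≡ get y (head0 S)
comp-ςTuple-head (b ∷ S) y         _         = refl
comp-ςTuple-head []      []        _         = refl
comp-ςTuple-head []      (p ∷ y)   (() ∷ _ , _)

module _ {s : Schema} {Δ : DB} (σ : Valuation) (wΔ : WFDB s Δ) where

  evalQ-WFTuple : ∀ {Q} → WFQ s Q → All (WFTuple (sch s Q)) (evalQ s σ Δ Q)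
  evalQ-WFTuple-at : ∀ {S Q} → S ≡ sch s Q → WFQ s Q → All (WFTuple S) (evalQ s σ Δ Q)
  evalQ-WFTuple (wrel {R})        = wΔ R
  evalQ-WFTuple (wproj {ψ} w ψ⊆S) = map⁺ (All.map (WFTuple-restrict ψ _ ψ⊆S) (evalQ-WFTuple w))
  evalQ-WFTuple (wsel w _)        = filter⁺ _ (evalQ-WFTuple w)
  evalQ-WFTuple (wjoin {Q = Q} {Q′} w w′ _ _) =
    filter⁺ _ (All-cross _++_ (λ {y} {z} → WFTuple-++ {sch s Q} {sch s Q′} y z)
                             (evalQ-WFTuple w) (evalQ-WFTuple w′))
  evalQ-WFTuple (wunion w w′ S≡S′) =
    ++⁺ (evalQ-WFTuple w) (evalQ-WFTuple-at S≡S′ w′)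
  evalQ-WFTuple (wdiff {Q' = Q′} w _ _) = All-minus tupleEq (evalQ s σ Δ Q′) (evalQ-WFTuple w)

  evalQ-WFTuple-at refl = evalQ-WFTuple

  evalT-ςQ : ∀ {Q} → WFQ s Q → evalT (ςDB s Δ) σ (ςQ s Q) ≡ map (ςTuple (sch s Q)) (evalQ s σ Δ Q)
  evalT-ςQ-at : ∀ {S Q} → S ≡ sch s Q → WFQ s Q → evalT (ςDB s Δ) σ (ςQ s Q) ≡ map (ςTuple S) (evalQ s σ Δ Q)
  holdsT-ςP : ∀ {S φ} → WFP s S φ → ∀ x → holdsT (ςDB s Δ) σ (ςTuple S x) (ςP s S φ) ≡ evalP s σ Δ x φ

  evalT-ςQ wrel = refl
  evalT-ςQ (wproj {ψ} {Q} w ψ⊆S) = begin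
    map (λ r → map (comp r) (map (pos S) ψ)) (evalT (ςDB s Δ) σ (ςQ s Q))
      ≡⟨ cong (map (λ r → map (comp r) (map (pos S) ψ))) (evalT-ςQ w) ⟩
    map (λ r → map (comp r) (map (pos S) ψ)) (map (ςTuple S) (evalQ s σ Δ Q))
      ≡⟨ map-∘ _ ⟨
    map (λ y → map (comp (ςTuple S y)) (map (pos S) ψ)) (evalQ s σ Δ Q)
      ≡⟨ map-cong (λ y → trans (sym (map-∘ ψ)) (map-cong-local (All.tabulate (project y)))) _ ⟩
    map (λ y → ςTuple ψ (restrict ψ y)) (evalQ s σ Δ Q)
      ≡⟨ map-∘ _ ⟩
    map (ςTuple ψ) (map (restrict ψ) (evalQ s σ Δ Q)) ∎
    where
    open ≡-Reasoning
    S = sch s Q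
    project : ∀ y {a} → a ∈ ψ → comp (ςTuple S y) (pos S a) ≡ get (restrict ψ y) a
    project y a∈ψ = trans (comp-map-pos (get y) S (All.lookup ψ⊆S a∈ψ)) (sym (get-restrict ψ y a∈ψ))
  evalT-ςQ (wsel {φ} {Q} w wφ) =
    trans (cong (filterᵇ _) (evalT-ςQ w)) (filterᵇ-map _ _ (ςTuple (sch s Q)) (holdsT-ςP wφ) (evalQ s σ Δ Q))
  evalT-ςQ (wjoin {φ} {Q} {Q′} w w′ S#S′ wφ) = begin
    filterᵇ holds (cross _++_ (evalT (ςDB s Δ) σ (ςQ s Q)) (evalT (ςDB s Δ) σ (ςQ s Q′)))
      ≡⟨ cong (filterᵇ holds) (cong₂ (cross _++_) (evalT-ςQ w) (evalT-ςQ w′)) ⟩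
    filterᵇ holds (cross _++_ (map (ςTuple S) (evalQ s σ Δ Q)) (map (ςTuple S′) (evalQ s σ Δ Q′)))
      ≡⟨ cong (filterᵇ holds) (cross-map _++_ _++_ (ςTuple S) (ςTuple S′) (ςTuple (S ++ S′))
                                 (λ {y} {z} wy _ → ςTuple-++ S S′ y z wy S#S′)
                                 (evalQ-WFTuple w) (evalQ-WFTuple w′)) ⟩
    filterᵇ holds (map (ςTuple (S ++ S′)) (cross _++_ (evalQ s σ Δ Q) (evalQ s σ Δ Q′)))
      ≡⟨ filterᵇ-map holds _ (ςTuple (S ++ S′)) (holdsT-ςP wφ) (cross _++_ (evalQ s σ Δ Q) (evalQ s σ Δ Q′)) ⟩
    map (ςTuple (S ++ S′)) (evalQ s σ Δ (join φ Q Q′)) ∎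
    where
    open ≡-Reasoning
    S = sch s Q
    S′ = sch s Q′
    holds : Row → Bool
    holds r = holdsT (ςDB s Δ) σ r (ςP s (S ++ S′) φ)
  evalT-ςQ (wunion {Q} {Q′} w w′ S≡S′) =
    trans (cong₂ _++_ (evalT-ςQ w) (evalT-ςQ-at S≡S′ w′))
          (sym (map-++ (ςTuple (sch s Q)) (evalQ s σ Δ Q) (evalQ s σ Δ Q′)))
  evalT-ςQ (wdiff {Q} {Q′} w w′ S≡S′) =
    trans (cong₂ (minus rowEq) (evalT-ςQ w) (evalT-ςQ-at S≡S′ w′))
          (minus-map rowEq tupleEq (ςTuple (sch s Q)) rowEq-ςTuple (evalQ s σ Δ Q′)
                     (evalQ-WFTuple w) (evalQ-WFTuple-at S≡S′ w′))

  evalT-ςQ-at refl w = evalT-ςQ w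

  holdsT-ςP {S} (wattAtt {o = o} a∈S a′∈S) x = cong₂ (cmp o) (comp-map-pos (get x) S a∈S) (comp-map-pos (get x) S a′∈S)
  holdsT-ςP {S} (wattVal {o = o} {v} a∈S) x = cong (λ u → cmp o u (v [ σ ])) (comp-map-pos (get x) S a∈S)
  holdsT-ςP {S} (wattIn {a} {Q} a∈S w) x =
    trans (cong (any (λ r → comp (ςTuple S x) (pos S a) ≡ᵇ comp r 0)) (evalT-ςQ w))
          (any-map-local _ _ (ςTuple (sch s Q))
             (All.map (λ {y} wy → cong₂ _≡ᵇ_ (comp-map-pos (get x) S a∈S) (comp-ςTuple-head (sch s Q) y wy))
                      (evalQ-WFTuple w)))
  holdsT-ςP (wand wφ wψ) x = cong₂ _∧_ (holdsT-ςP wφ x) (holdsT-ςP wψ x)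
  holdsT-ςP (wor wφ wψ)  x = cong₂ _∨_ (holdsT-ςP wφ x) (holdsT-ςP wψ x)
  holdsT-ςP (wneg wφ)    x = cong not (holdsT-ςP wφ x)

lemmaA1 : (s : Schema) (Δ : DB) (σ : Valuation) (R : RelName) (c : Tuple) (φ : Pred) →
          WFDB s Δ → WFTuple (s R) c → WFP s (s R) φ →
          (interp (ςDB s Δ) σ (ςTuple (s R) c) ⊨ ςP s (s R) φ) ⇔ (evalP s σ Δ c φ ≡ true)
lemmaA1 s Δ σ R c φ wΔ _ wφ = subst (λ b → T b ⇔ (evalP s σ Δ c φ ≡ true)) (sym (holdsT-ςP σ wΔ wφ c)) T-≡
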